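{- Let $n>3$ and let $Y$ be a generalized truncation of the complete graph $K_n$ in which every constituent graph is Hamilton-connected. Then $Y$ is Hamilton-connected.
   Context: Generalized truncation of a graph $X$: take a matching $M_0$ with $|M_0|=|E(X)|$ (on $2|E(X)|$ new vertices) and a bijection $F:E(X)\to M_0$; for each edge $e$ of $X$ with ends $u,v$, label one end of $F(e)$ by $u$ and the other by $v$. For $v\in V(X)$, the cluster $\mathrm{cl}(v)$ is the set of vertices labelled $v$; insert an arbitrary graph $\mathrm{con}(v)$ (the constituent at $v$) on $\mathrm{cl}(v)$. The result $F(M_0)\cup\bigcup_v\mathrm{con}(v)$ is a generalized truncation of $X$. A graph is Hamilton-connected if for every pair of distinct vertices there is a Hamilton path with those two vertices as its ends. -}

module Defs where

open import Data.Nat using (ℕ)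
open import Data.Fin using (Fin)
open import Data.List using (List; []; _∷_)
open import Data.List.Membership.Propositional using (_∈_)
open import Data.List.Relation.Unary.Unique.Propositional using (Unique)
open import Data.Product using (Σ; Σ-syntax; _×_; _,_)
open import Relation.Binary.PropositionalEquality using (_≡_; _≢_)
open import Relation.Nullary using (¬_)

record Graph (V : Set) : Set₁ where
  field
    Adj    : V → V → Set
    sym    : ∀ {x y} → Adj x y → Adj y x
    irrefl : ∀ {x} → ¬ Adj x x
open Graph public

K : (n : ℕ) → Graph (Fin n)
K n = record { Adj = λ u v → u ≢ v
             ; sym = λ p q → p (Relation.Binary.PropositionalEquality.sym q)
             ; irrefl = λ p → p _≡_.refl }

data Walk {V : Set} (R : V → V → Set) : V → V → List V → Set where
  stop : ∀ a → Walk R a a (a ∷ [])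
  step : ∀ {a b c xs} → R a b → Walk R b c xs → Walk R a c (a ∷ xs)

HamiltonPath : {V : Set} → (V → V → Set) → V → V → Set
HamiltonPath {V} R a b =
  Σ[ xs ∈ List V ] (Walk R a b xs × Unique xs × (∀ v → v ∈ xs))

HamiltonConnected : {V : Set} → (V → V → Set) → Set
HamiltonConnected {V} R = ∀ (a b : V) → a ≢ b → HamiltonPath R a b

-- The matching M₀ is identified with E(X) via F, and the end
-- of F(e), e = uv, labelled u is identified with the dart (u , v).  So the cluster cl(u)
-- is the set of neighbours w of u in X (the end of F(uw) labelled u).
record Cl {V : Set} (X : Graph V) (u : V) : Set where
  constructor cl
  field
    other : V
    .adj  : Adj X u other

TVert : {V : Set} → Graph V → Set
TVert {V} X = Σ V (Cl X)

data TruncAdj {V : Set} (X : Graph V) (con : (v : V) → Graph (Cl X v))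
       : TVert X → TVert X → Set where
  inside  : ∀ {v} {x y : Cl X v} → Adj (con v) x y → TruncAdj X con (v , x) (v , y)
  matched : ∀ {u v} .(p : Adj X u v) →
            TruncAdj X con (u , cl v p) (v , cl u (Graph.sym X p))

-- Every cluster cl(u) consists of the ends of the matching edges at u, one for each other
-- vertex of K n, so any ordering c₁, …, cₖ of distinct vertices of K n can be followed
-- through Y: traverse cl(cᵢ) by a Hamilton path of con(cᵢ), entering at the end matched to
-- cᵢ₋₁ and leaving at the end matched to cᵢ₊₁.  Ends x ∈ cl(u), x′ ∈ cl(v) with u ≠ v are
-- joined by such a route u, d₁, …, d₂, v through all clusters as soon as x is not matched
-- to d₁ and x′ not to d₂; since n > 3 this can be arranged when x is matched to v or x′ to
-- u.  Otherwise, and for two ends in one cluster, take a Hamilton path of cl(u) from x (to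
-- the end matched to v, resp. to x′) and replace its first edge x y by an excursion that
-- leaves along the matching edge at x, runs through all clusters not yet visited, and
-- returns along the matching edge at y; in the first case finish by crossing to cl(v).

module Submission where

open import Defs hiding (sym; irrefl)
open import Level using (0ℓ)
open import Data.Nat using (ℕ; _<_)
open import Data.Fin using (Fin; _≟_)
open import Data.Fin.Properties using (all?; ¬∀⟶∃¬; pigeonhole; <⇒≢)
open import Data.List using (List; []; _∷_; _++_; map; filter; allFin; length; lookup)
open import Data.List.Membership.Propositional using (_∈_; _∉_)
open import Data.List.Membership.Propositional.Properties
  using (∈-++⁻; ∈-++⁺ˡ; ∈-++⁺ʳ; ∈-map⁻; ∈-map⁺; ∈-filter⁻; ∈-filter⁺; ∈-allFin)
open import Data.List.Relation.Unary.Any using (here; there; index)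
open import Data.List.Relation.Unary.Any.Properties using (lookup-index)
open import Data.List.Relation.Unary.All using ([]; _∷_; tabulate)
open import Data.List.Relation.Unary.All.Properties.Core using (All¬⇒¬Any)
open import Data.List.Relation.Unary.AllPairs using ([]; _∷_)
open import Data.List.Relation.Unary.Unique.Propositional using (Unique)
import Data.List.Relation.Unary.Unique.Propositional.Properties as Unique
open import Data.Product using (∃; _×_; _,_; proj₁; proj₂)
open import Data.Product.Properties using (≡-dec)
open import Data.Sum using (inj₁; inj₂; assocˡ) renaming (map to ⊎-map)
open import Data.Empty using (⊥-elim)
import Data.Empty.Irrelevant as Irrelevant
open import Function using (_∘_)
open import Relation.Nullary using (yes; no; ¬?)
open import Relation.Nullary.Decidable using (map′)
open import Relation.Unary using (Pred; _⊆_; _≐_; _∪_; _∖_; ｛_｝; _⊥′_)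
open import Relation.Binary.Definitions using (DecidableEquality)
open import Relation.Binary.PropositionalEquality using (_≡_; _≢_; refl; sym; trans; cong; subst)

open Cl using (other)

module _ {V : Set} {R : V → V → Set} where

  walk-++ : ∀ {a b c d xs ys} → Walk R a b xs → R b c → Walk R c d ys → Walk R a d (xs ++ ys)
  walk-++ (stop a)   r w′ = step r w′
  walk-++ (step s w) r w′ = step s (walk-++ w r w′)

  walk-start : ∀ {a b xs} → Walk R a b xs → a ∈ xs
  walk-start (stop a)   = here refl
  walk-start (step _ _) = here refl

  walk-end : ∀ {a b xs} → Walk R a b xs → b ∈ xs
  walk-end (stop a)   = here refl
  walk-end (step _ w) = there (walk-end w)

walk-map : ∀ {V W : Set} {R : V → V → Set} {S : W → W → Set} (f : V → W) →
           (∀ {x y} → R x y → S (f x) (f y)) →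
           ∀ {a b xs} → Walk R a b xs → Walk S (f a) (f b) (map f xs)
walk-map f hom (stop a)   = stop (f a)
walk-map f hom (step r w) = step (hom r) (walk-map f hom w)

record SpanningPath {V : Set} (R : V → V → Set) (s t : V) (P : Pred V 0ℓ) : Set where
  constructor spanning
  field
    {vertices} : List V
    walk       : Walk R s t vertices
    unique     : Unique vertices
    sound      : (λ y → y ∈ vertices) ⊆ P
    complete   : P ⊆ (λ y → y ∈ vertices)

module _ {V : Set} {R : V → V → Set} where

  single : ∀ x → SpanningPath R x x ｛ x ｝
  single x = spanning (stop x) ([] ∷ []) (λ { (here refl) → refl }) (λ { refl → here refl })

  join : ∀ {s t s′ t′ P Q} → SpanningPath R s t P → R t s′ → SpanningPath R s′ t′ Q → P ⊥′ Q →
         SpanningPath R s t′ (P ∪ Q)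
  join (spanning {xs} w u i o) r (spanning w′ u′ i′ o′) P⊥Q = spanning
    (walk-++ w r w′)
    (Unique.++⁺ u u′ (λ (m , m′) → P⊥Q _ (i m , i′ m′)))
    (λ m → ⊎-map i i′ (∈-++⁻ xs m))
    (λ { (inj₁ p) → ∈-++⁺ˡ (o p) ; (inj₂ q) → ∈-++⁺ʳ xs (o′ q) })

  resp-≐ : ∀ {s t P Q} → SpanningPath R s t P → P ≐ Q → SpanningPath R s t Q
  resp-≐ (spanning w u i o) (P⊆Q , Q⊆P) = spanning w u (P⊆Q ∘ i) (o ∘ Q⊆P)

  start : ∀ {s t P} → SpanningPath R s t P → P s
  start (spanning w _ i _) = i (walk-start w)

  tail : ∀ {a b P} → SpanningPath R a b P → a ≢ b → ∃ λ q → SpanningPath R q b (P ∖ ｛ a ｝)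
  tail (spanning (stop _) _ _ _) a≢b = ⊥-elim (a≢b refl)
  tail {a} {P = P} (spanning (step {b = q} {xs = xs} _ w) u@(_ ∷ u′) i o) _ =
    q , spanning w u′ (λ m → i (there m) , λ a≡y → a∉xs (subst (_∈ xs) (sym a≡y) m)) rest
    where
    a∉xs : a ∉ xs
    a∉xs = Unique.Unique[x∷xs]⇒x∉xs u
    rest : ∀ {y} → (P ∖ ｛ a ｝) y → y ∈ xs
    rest (p , a≢y) with o p
    ... | here y≡a = ⊥-elim (a≢y (sym y≡a))
    ... | there m  = m

  closed⇒singleton : ∀ {a b P} → SpanningPath R a b P → a ≡ b → P ⊆ ｛ a ｝
  closed⇒singleton (spanning (stop _) _ _ o) refl p with o p
  ... | here y≡a = sym y≡a
  closed⇒singleton (spanning (step _ w) u _ _) refl =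
    ⊥-elim (Unique.Unique[x∷xs]⇒x∉xs u (walk-end w))

  toHamiltonPath : ∀ {a b P} → SpanningPath R a b P → (∀ y → P y) → HamiltonPath R a b
  toHamiltonPath (spanning {xs} w u _ o) total = xs , w , u , o ∘ total

module _ {n : ℕ} where

  open import Data.List.Membership.DecPropositional (_≟_ {n}) using (_∈?_)

  ∃∉ : (X : List (Fin n)) → length X < n → ∃ λ d → d ∉ X
  ∃∉ X |X|<n with all? (_∈? X)
  ... | no ¬all = ¬∀⟶∃¬ n (_∈ X) (_∈? X) ¬all
  ... | yes all∈ with pigeonhole |X|<n (index ∘ all∈)
  ...   | i , j , i<j , eq = ⊥-elim (<⇒≢ i<j i≡j)
    where
    i≡j : i ≡ j
    i≡j = trans (lookup-index (all∈ i))
                (trans (cong (lookup X) eq) (sym (lookup-index (all∈ j))))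

  complementRoute : (Z : List (Fin n)) {w w′ : Fin n} → w ≢ w′ → w ∉ Z → w′ ∉ Z →
                    ∃ λ ms → Unique (w ∷ ms ++ w′ ∷ []) ×
                             (λ c → c ∈ w ∷ ms ++ w′ ∷ []) ≐ (λ c → c ∉ Z)
  complementRoute Z {w} {w′} w≢w′ w∉Z w′∉Z = ms , uniq , onRoute⇒∉ , ∉⇒onRoute
    where
    ends : List (Fin n)
    ends = w ∷ w′ ∷ Z
    ms : List (Fin n)
    ms = filter (λ c → ¬? (c ∈? ends)) (allFin n)
    ms-∉ : ∀ {c} → c ∈ ms → c ∉ ends
    ms-∉ m = proj₂ (∈-filter⁻ (λ c → ¬? (c ∈? ends)) {xs = allFin n} m)
    uniq : Unique (w ∷ ms ++ w′ ∷ [])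
    uniq = tabulate w≢later ∷ Unique.++⁺ (Unique.filter⁺ _ (Unique.allFin⁺ n)) ([] ∷ [])
                                  (λ { (m , here refl) → ms-∉ m (there (here refl)) })
      where
      w≢later : ∀ {c} → c ∈ ms ++ w′ ∷ [] → w ≢ c
      w≢later m refl with ∈-++⁻ ms m
      ... | inj₁ m′        = ms-∉ m′ (here refl)
      ... | inj₂ (here eq) = w≢w′ eq
    onRoute⇒∉ : ∀ {c} → c ∈ w ∷ ms ++ w′ ∷ [] → c ∉ Z
    onRoute⇒∉ (here refl) = w∉Z
    onRoute⇒∉ (there m) with ∈-++⁻ ms m
    ... | inj₁ m′          = ms-∉ m′ ∘ there ∘ there
    ... | inj₂ (here refl) = w′∉Z
    ∉⇒onRoute : ∀ {c} → c ∉ Z → c ∈ w ∷ ms ++ w′ ∷ []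
    ∉⇒onRoute {c} c∉Z with c ∈? ends
    ... | yes (here c≡w)                = here c≡w
    ... | yes (there (here c≡w′))       = there (∈-++⁺ʳ ms (here c≡w′))
    ... | yes (there (there c∈Z))       = ⊥-elim (c∉Z c∈Z)
    ... | no c∉ends                     =
      there (∈-++⁺ˡ (∈-filter⁺ (λ c → ¬? (c ∈? ends)) (∈-allFin c) c∉ends))

  private
    C : Fin n → Set
    C = Cl (K n)

    Y : Set
    Y = TVert (K n)

  other-injective : ∀ {u} {x y : C u} → other x ≡ other y → x ≡ y
  other-injective {x = cl _ _} {cl _ _} refl = refl

  other≢ : ∀ {u} (x : C u) → other x ≢ u
  other≢ (cl _ adj) refl = Irrelevant.⊥-elim (adj refl)

  pair-injective : ∀ {c} {x y : C c} → _≡_ {A = Y} (c , x) (c , y) → x ≡ y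
  pair-injective = other-injective ∘ cong (other ∘ proj₂)

  _≟ᶜ_ : ∀ {u} → DecidableEquality (C u)
  x ≟ᶜ y = map′ other-injective (cong other) (other x ≟ other y)

  _≟ᵀ_ : DecidableEquality Y
  _≟ᵀ_ = ≡-dec _≟_ _≟ᶜ_

  InCluster : Fin n → Pred Y 0ℓ
  InCluster c y = proj₁ y ≡ c

  OnRoute : List (Fin n) → Pred Y 0ℓ
  OnRoute cs y = proj₁ y ∈ cs

  Outside : List (Fin n) → Pred Y 0ℓ
  Outside Z y = proj₁ y ∉ Z

  module Constituents (con : (v : Fin n) → Graph (C v))
           (hamiltonian : ∀ v → HamiltonConnected (Adj (con v))) where

    private
      E : Y → Y → Set
      E = TruncAdj (K n) con

    clusterPath : ∀ c {x y : C c} → x ≢ y → SpanningPath E (c , x) (c , y) (InCluster c)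
    clusterPath c {x} {y} x≢y with hamiltonian c x y x≢y
    ... | xs , w , u , cov = spanning
      (walk-map (c ,_) inside w)
      (Unique.map⁺ pair-injective u)
      (λ m → let _ , _ , y≡ = ∈-map⁻ (c ,_) m in cong proj₁ y≡)
      (λ { {_ , z} refl → ∈-map⁺ (c ,_) (cov z) })

    clusterTail : ∀ {c b} {x : C c} → SpanningPath E (c , x) b (InCluster c) → (c , x) ≢ b →
                  ∃ λ (x′ : C c) → SpanningPath E (c , x′) b (InCluster c ∖ ｛ c , x ｝)
    clusterTail p ne with tail p ne
    ... | (_ , x′) , rest with start rest
    ...   | refl , _ = x′ , rest

    enterRoute : ∀ {c d ds t} (s : C c) (c∉ : c ∉ d ∷ ds) → other s ≢ d →
                 SpanningPath E (d , cl c (c∉ ∘ here ∘ sym)) t (OnRoute (d ∷ ds)) →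
                 SpanningPath E (c , s) t (OnRoute (c ∷ d ∷ ds))
    enterRoute {c} {d} {ds} s c∉ s≢d rest =
      resp-≐ (join (clusterPath c (s≢d ∘ cong other)) (matched (c∉ ∘ here)) rest disjoint)
             ((λ { (inj₁ p) → here p ; (inj₂ m) → there m }) ,
              (λ { (here p) → inj₁ p ; (there m) → inj₂ m }))
      where
      disjoint : InCluster c ⊥′ OnRoute (d ∷ ds)
      disjoint _ (refl , m) = c∉ m

    throughRoute : ∀ c (s : C c) ms e (t : C e) → Unique (c ∷ ms ++ e ∷ []) →
                   other s ∉ c ∷ ms ++ e ∷ [] → other t ∉ c ∷ ms ++ e ∷ [] →
                   SpanningPath E (c , s) (e , t) (OnRoute (c ∷ ms ++ e ∷ []))
    throughRoute c s [] e t ((c≢e ∷ []) ∷ _) s∉ t∉ =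
      enterRoute s (All¬⇒¬Any (c≢e ∷ [])) (s∉ ∘ there ∘ here)
        (resp-≐ (clusterPath e (t∉ ∘ here ∘ sym ∘ cong other))
                (here , λ { (here p) → p }))
    throughRoute c s (d ∷ ms) e t (c≢later ∷ uniq) s∉ t∉ =
      enterRoute s (All¬⇒¬Any c≢later) (s∉ ∘ there ∘ here)
        (throughRoute d _ ms e t uniq (All¬⇒¬Any c≢later) (t∉ ∘ there))

    throughComplement : ∀ Z {w w′} (s : C w) (t : C w′) → w ≢ w′ → w ∉ Z → w′ ∉ Z →
                        other s ∈ Z → other t ∈ Z → SpanningPath E (w , s) (w′ , t) (Outside Z)
    throughComplement Z s t w≢w′ w∉Z w′∉Z s∈Z t∈Z
      with complementRoute Z w≢w′ w∉Z w′∉Z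
    ... | ms , uniq , onRoute⇒∉ , ∉⇒onRoute =
      resp-≐ (throughRoute _ s ms _ t uniq (λ m → onRoute⇒∉ m s∈Z) (λ m → onRoute⇒∉ m t∈Z))
             (onRoute⇒∉ , ∉⇒onRoute)

    detour : ∀ {Z c b} {x x′ : C c} → c ∈ Z → other x ∉ Z → other x′ ∉ Z →
             SpanningPath E (c , x′) b (InCluster c ∖ ｛ c , x ｝) →
             SpanningPath E (c , x) b (InCluster c ∪ Outside Z)
    detour {Z} {c} {x = x} {x′} c∈Z x∉Z x′∉Z rest =
      resp-≐ (join (single (c , x)) (matched (other≢ x ∘ sym))
               (join excursion (matched (other≢ x′)) rest outside⊥rest) start⊥others)
             (merge , split)
      where
      partners≢ : other x ≢ other x′
      partners≢ = proj₂ (start rest) ∘ cong (c ,_) ∘ other-injective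
      excursion : SpanningPath E (other x , cl c (other≢ x)) (other x′ , cl c (other≢ x′)) (Outside Z)
      excursion = throughComplement Z _ _ partners≢ x∉Z x′∉Z c∈Z c∈Z
      outside⊥rest : Outside Z ⊥′ (InCluster c ∖ ｛ c , x ｝)
      outside⊥rest _ (y∉Z , refl , _) = y∉Z c∈Z
      start⊥others : ｛ c , x ｝ ⊥′ (Outside Z ∪ (InCluster c ∖ ｛ c , x ｝))
      start⊥others _ (refl , inj₁ x∉Z) = x∉Z c∈Z
      start⊥others _ (refl , inj₂ (_ , ≢x)) = ≢x refl
      merge : ｛ c , x ｝ ∪ (Outside Z ∪ (InCluster c ∖ ｛ c , x ｝)) ⊆ InCluster c ∪ Outside Z
      merge (inj₁ refl)             = inj₁ refl
      merge (inj₂ (inj₁ y∉Z))       = inj₂ y∉Z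
      merge (inj₂ (inj₂ (y∈c , _))) = inj₁ y∈c
      split : InCluster c ∪ Outside Z ⊆ ｛ c , x ｝ ∪ (Outside Z ∪ (InCluster c ∖ ｛ c , x ｝))
      split (inj₂ y∉Z) = inj₂ (inj₁ y∉Z)
      split {y} (inj₁ y∈c) with (c , x) ≟ᵀ y
      ... | yes y≡x = inj₁ y≡x
      ... | no  y≢x = inj₂ (inj₂ (y∈c , y≢x))

    withinCluster : ∀ {c} {x x′ : C c} → x ≢ x′ → HamiltonPath E (c , x) (c , x′)
    withinCluster {c} {x} x≢x′ =
      let x₂ , rest = clusterTail (clusterPath c x≢x′) (x≢x′ ∘ pair-injective)
      in toHamiltonPath (detour (here refl) (other∉ x) (other∉ x₂) rest) cover
      where
      other∉ : (z : C c) → other z ∉ c ∷ []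
      other∉ z (here z→c) = other≢ z z→c
      cover : ∀ y → (InCluster c ∪ Outside (c ∷ [])) y
      cover y with proj₁ y ∈? c ∷ []
      ... | yes (here y∈c) = inj₁ y∈c
      ... | no  y∉c        = inj₂ y∉c

    twoClusters : ∀ {u v} y → (InCluster u ∪ Outside (u ∷ v ∷ []) ∪ InCluster v) y
    twoClusters {u} {v} y with proj₁ y ∈? u ∷ v ∷ []
    ... | yes (here y∈u)         = inj₁ y∈u
    ... | yes (there (here y∈v)) = inj₂ (inj₂ y∈v)
    ... | no  y∉uv               = inj₂ (inj₁ y∉uv)

    acrossRoute : ∀ {u v d₁ d₂} {x : C u} {x′ : C v} → d₁ ≢ d₂ →
                  d₁ ∉ u ∷ v ∷ [] → d₂ ∉ u ∷ v ∷ [] → other x ≢ d₁ → other x′ ≢ d₂ →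
                  u ≢ v → HamiltonPath E (u , x) (v , x′)
    acrossRoute {u} {v} d₁≢d₂ d₁∉ d₂∉ x≢d₁ x′≢d₂ u≢v = toHamiltonPath
      (join (clusterPath u (x≢d₁ ∘ cong other)) (matched (d₁∉ ∘ here ∘ sym))
        (join (throughComplement (u ∷ v ∷ []) _ _ d₁≢d₂ d₁∉ d₂∉ (here refl) (there (here refl)))
              (matched (d₂∉ ∘ there ∘ here))
              (clusterPath v (x′≢d₂ ∘ sym ∘ cong other))
              outside⊥v)
        u⊥rest)
      twoClusters
      where
      outside⊥v : Outside (u ∷ v ∷ []) ⊥′ InCluster v
      outside⊥v _ (y∉uv , refl) = y∉uv (there (here refl))
      u⊥rest : InCluster u ⊥′ (Outside (u ∷ v ∷ []) ∪ InCluster v)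
      u⊥rest _ (refl , inj₁ y∉uv) = y∉uv (here refl)
      u⊥rest _ (refl , inj₂ u≡v)  = u≢v u≡v

    acrossFromMatched : 3 < n → ∀ {u v} {x : C u} {x′ : C v} → other x ≡ v →
                        u ≢ v → HamiltonPath E (u , x) (v , x′)
    acrossFromMatched 3<n {u} {v} {x′ = x′} refl =
      let d₂ , d₂∉ = ∃∉ (u ∷ v ∷ other x′ ∷ []) 3<n
          d₁ , d₁∉ = ∃∉ (u ∷ v ∷ d₂ ∷ []) 3<n
      in acrossRoute (d₁∉ ∘ there ∘ there ∘ here) (d₁∉ ∘ ∈-++⁺ˡ) (d₂∉ ∘ ∈-++⁺ˡ)
                     (d₁∉ ∘ there ∘ here ∘ sym) (d₂∉ ∘ there ∘ there ∘ here ∘ sym)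

    acrossToMatched : 3 < n → ∀ {u v} {x : C u} {x′ : C v} → other x′ ≡ u →
                      u ≢ v → HamiltonPath E (u , x) (v , x′)
    acrossToMatched 3<n {u} {v} {x} refl =
      let d₁ , d₁∉ = ∃∉ (u ∷ v ∷ other x ∷ []) 3<n
          d₂ , d₂∉ = ∃∉ (u ∷ v ∷ d₁ ∷ []) 3<n
      in acrossRoute (d₂∉ ∘ there ∘ there ∘ here ∘ sym) (d₁∉ ∘ ∈-++⁺ˡ) (d₂∉ ∘ ∈-++⁺ˡ)
                     (d₁∉ ∘ there ∘ there ∘ here ∘ sym) (d₂∉ ∘ here ∘ sym)

    acrossDetour : 3 < n → ∀ {u v} {x : C u} {x′ : C v} → other x ≢ v → other x′ ≢ u →
                   u ≢ v → HamiltonPath E (u , x) (v , x′)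
    acrossDetour 3<n {u} {v} {x} x≢v x′≢u u≢v =
      let x₂ , rest = clusterTail (clusterPath u x≢end) (x≢end ∘ pair-injective)
      in toHamiltonPath
           (join (detour (here refl) (other∉ x x≢v) (other∉ x₂ (successor≢ rest)) rest)
                 (matched u≢v) (clusterPath v (x′≢u ∘ sym ∘ cong other)) u∪outside⊥v)
           (assocˡ ∘ twoClusters)
      where
      x≢end : x ≢ cl v u≢v
      x≢end = x≢v ∘ cong other
      other∉ : (z : C u) → other z ≢ v → other z ∉ u ∷ v ∷ []
      other∉ z _   (here z→u)         = other≢ z z→u
      other∉ z z≢v (there (here z→v)) = z≢v z→v
      -- n > 3 leaves a vertex of cl(u) other than x and the one matched to v.
      successor≢ : ∀ {x₂} → SpanningPath E (u , x₂) (u , cl v u≢v) (InCluster u ∖ ｛ u , x ｝) →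
                   other x₂ ≢ v
      successor≢ {x₂} rest x₂→v with ∃∉ (u ∷ v ∷ other x ∷ []) 3<n
      ... | d , d∉ = d∉ (there (here (trans (sym x₂→d) x₂→v)))
        where
        x₂→d : other x₂ ≡ d
        d≢x : _≢_ {A = Y} (u , x) (u , cl d (d∉ ∘ here ∘ sym))
        d≢x = d∉ ∘ there ∘ there ∘ here ∘ sym ∘ cong (other ∘ proj₂)
        x₂→d = cong (other ∘ proj₂)
                 (closed⇒singleton rest (cong (u ,_) (other-injective x₂→v)) (refl , d≢x))
      u∪outside⊥v : (InCluster u ∪ Outside (u ∷ v ∷ [])) ⊥′ InCluster v
      u∪outside⊥v _ (inj₁ refl , u≡v)    = u≢v u≡v
      u∪outside⊥v _ (inj₂ y∉uv , refl)  = y∉uv (there (here refl))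

theorem5p2 : (n : ℕ) → 3 < n →
    (con : (v : Fin n) → Graph (Cl (K n) v)) →
    (∀ v → HamiltonConnected (Adj (con v))) →
    HamiltonConnected (TruncAdj (K n) con)
theorem5p2 n 3<n con hamiltonian = connect
  where
  open Constituents con hamiltonian
  connect : HamiltonConnected (TruncAdj (K n) con)
  connect (u , x) (v , x′) a≢b with u ≟ v | other x ≟ v | other x′ ≟ u
  ... | yes refl | _       | _        = withinCluster (a≢b ∘ cong (u ,_))
  ... | no u≢v   | yes x→v | _        = acrossFromMatched 3<n x→v u≢v
  ... | no u≢v   | no _    | yes x′→u = acrossToMatched 3<n x′→u u≢v
  ... | no u≢v   | no x↛v  | no x′↛u  = acrossDetour 3<n x↛v x′↛u u≢v
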